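{- Let $T$ be a non-deterministic register transducer with $k$ registers. Then the language $L_\otimes(T)=\{\rho_1\otimes\rho_2 \mid \rho_1,\rho_2 \text{ accepting runs of } T\}$ is recognised by a non-deterministic register automaton with $2k$ registers.
   Context: Fix finite alphabets $\Sigma$ (input) and $\Gamma$ (output), a countably infinite set $\mathcal{D}$ of data values and a distinguished data value $d_0\in\mathcal{D}$. Given a finite set $R$ of registers, a test is a Boolean formula built from $\top,\bot$ and atoms $r^{=}$, $r^{\neq}$ ($r\in R$) using $\wedge,\vee,\neg$; for a valuation $\tau:R\to\mathcal{D}$ and $d\in\mathcal{D}$, $\tau,d\models r^{=}$ iff $\tau(r)=d$ and $\tau,d\models r^{\neq}$ iff $\tau(r)\neq d$. A non-deterministic register transducer (NRT) is $T=(Q,R,i_0,F,\Delta)$ with $Q$ a finite set of states, $i_0\in Q$ initial, $F\subseteq Q$ accepting, $R$ a finite set of registers ($T$ has $k=|R|$ registers), and a finite set of transitions $\Delta\subseteq Q\times\Sigma\times\mathrm{Tests}_R\times 2^R\times(\Gamma\times R)^*\times Q$. A configuration is $(q,\tau)$ with $\tau:R\to\mathcal{D}$. From $(q,\tau)$, reading $(\sigma,d)\in\Sigma\times\mathcal{D}$, a transition $(q,\sigma,\phi,\mathrm{asgn},o,q')$ with $\tau,d\models\phi$ leads to $(q',\tau')$ where $\tau'(r)=d$ for $r\in\mathrm{asgn}$ and $\tau'(r)=\tau(r)$ otherwise, and produces the output $(\gamma_1,\tau'(r_1))\cdots(\gamma_m,\tau'(r_m))$ where $o=(\gamma_1,r_1)\cdots(\gamma_m,r_m)$.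 A run is an infinite sequence of such steps $(q_0,\tau_0)\xrightarrow{(u_1,u_1')}(q_1,\tau_1)\xrightarrow{(u_2,u_2')}\cdots$ with $u_n\in\Sigma\times\mathcal{D}$ the letter read and $u_n'\in(\Gamma\times\mathcal{D})^*$ the output produced; it is accepting if $(q_0,\tau_0)=(i_0,\tau_0^R)$ where $\tau_0^R(r)=d_0$ for all $r$, and some state of $F$ occurs infinitely often. Standing assumption: the output $u_1'u_2'\cdots$ of every accepting run is infinite. For two runs $\rho_1$ with steps $(u_n,u_n')$ and $\rho_2$ with steps $(v_n,v_n')$, their interleaving is the data word $\rho_1\otimes\rho_2=u_1u_1'v_1v_1'u_2u_2'v_2v_2'\cdots$ over the finite alphabet $\Sigma\cup\Gamma$. A non-deterministic register automaton (NRA) over a finite alphabet $A$ is defined like an NRT over input alphabet $A$ but whose transitions produce no output (all $o=\varepsilon$, and no infiniteness requirement on output); its language is the set of infinite data words in $(A\times\mathcal{D})^\omega$ which are inputs of accepting runs. -}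

module Defs where

open import Data.Nat using (ℕ; zero; suc; _≤_)
open import Data.Fin using (Fin)
open import Data.Fin.Subset using (Subset; _∈_)
open import Data.Vec using (lookup)
open import Data.Bool using (if_then_else_)
open import Data.List using (List; []; _∷_; map)
open import Data.List.NonEmpty using (List⁺; _∷_)
import Data.List.Membership.Propositional as LM
open import Data.Product using (_×_; _,_; proj₁; proj₂; ∃-syntax)
open import Data.Sum using (_⊎_; inj₁; inj₂)
open import Data.Empty using (⊥)
open import Data.Unit using (⊤)
open import Relation.Nullary using (¬_)
open import Relation.Binary.PropositionalEquality using (_≡_; _≢_)
open import Function.Bundles using (_↔_)

Finite : Set → Set
Finite A = ∃[ n ] (A ↔ Fin n)

CountablyInfinite : Set → Set
CountablyInfinite A = A ↔ ℕ

Word : Set → Set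
Word X = ℕ → X

data Test (k : ℕ) : Set where
  tt ff : Test k
  eq neq : Fin k → Test k
  _∧_ _∨_ : Test k → Test k → Test k
  not : Test k → Test k

⟦_⟧ : {D : Set} {k : ℕ} → Test k → (Fin k → D) → D → Set
⟦ tt ⟧ τ d = ⊤
⟦ ff ⟧ τ d = ⊥
⟦ eq r ⟧ τ d = τ r ≡ d
⟦ neq r ⟧ τ d = τ r ≢ d
⟦ φ ∧ ψ ⟧ τ d = ⟦ φ ⟧ τ d × ⟦ ψ ⟧ τ d
⟦ φ ∨ ψ ⟧ τ d = ⟦ φ ⟧ τ d ⊎ ⟦ ψ ⟧ τ d
⟦ not φ ⟧ τ d = ¬ ⟦ φ ⟧ τ d

upd : {D : Set} {k : ℕ} → (Fin k → D) → Subset k → D → Fin k → D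
upd τ a d r = if lookup a r then d else τ r

record TransT (Sig Gam : Set) (k nQ : ℕ) : Set where
  field
    src  : Fin nQ
    lab  : Sig
    test : Test k
    asgn : Subset k
    out  : List (Gam × Fin k)
    tgt  : Fin nQ

record NRT (Sig Gam : Set) (k : ℕ) : Set where
  field
    nQ    : ℕ
    init  : Fin nQ
    acc   : Subset nQ
    trans : List (TransT Sig Gam k nQ)

module _ {Sig Gam D : Set} {k : ℕ} (T : NRT Sig Gam k) where
  open NRT T
  open TransT

  -- inp n is the letter read from configuration n to configuration n+1,
  -- outp n the output produced by that step.
  record RunT : Set where
    field
      st   : ℕ → Fin nQ
      val  : ℕ → Fin k → D
      inp  : ℕ → Sig × D
      outp : ℕ → List (Gam × D)
      step : ∀ n → ∃[ t ] (LM._∈_ t trans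
               × src t ≡ st n
               × lab t ≡ proj₁ (inp n)
               × ⟦ test t ⟧ (val n) (proj₂ (inp n))
               × (∀ r → val (suc n) r ≡ upd (val n) (asgn t) (proj₂ (inp n)) r)
               × tgt t ≡ st (suc n)
               × outp n ≡ map (λ p → proj₁ p , val (suc n) (proj₂ p)) (out t))

  AcceptingT : D → RunT → Set
  AcceptingT d₀ ρ = st 0 ≡ init × (∀ r → val 0 r ≡ d₀)
                    × (∀ N → ∃[ n ] (N ≤ n × st n ∈ acc))
    where open RunT ρ

  OutputInfinite : D → Set
  OutputInfinite d₀ = ∀ (ρ : RunT) → AcceptingT d₀ ρ →
    ∀ N → ∃[ n ] (N ≤ n × RunT.outp ρ n ≢ [])

record TransA (A : Set) (k nQ : ℕ) : Set where
  field
    src  : Fin nQ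
    lab  : A
    test : Test k
    asgn : Subset k
    tgt  : Fin nQ

record NRA (A : Set) (k : ℕ) : Set where
  field
    nQ    : ℕ
    init  : Fin nQ
    acc   : Subset nQ
    trans : List (TransA A k nQ)

module _ {A D : Set} {k : ℕ} (M : NRA A k) where
  open NRA M
  open TransA

  record RunA : Set where
    field
      st   : ℕ → Fin nQ
      val  : ℕ → Fin k → D
      inp  : ℕ → A × D
      step : ∀ n → ∃[ t ] (LM._∈_ t trans
               × src t ≡ st n
               × lab t ≡ proj₁ (inp n)
               × ⟦ test t ⟧ (val n) (proj₂ (inp n))
               × (∀ r → val (suc n) r ≡ upd (val n) (asgn t) (proj₂ (inp n)) r)
               × tgt t ≡ st (suc n))

  AcceptingA : D → RunA → Set
  AcceptingA d₀ ρ = st 0 ≡ init × (∀ r → val 0 r ≡ d₀)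
                    × (∀ N → ∃[ n ] (N ≤ n × st n ∈ acc))
    where open RunA ρ

  LangA : D → Word (A × D) → Set
  LangA d₀ w = ∃[ ρ ] (AcceptingA d₀ ρ × (∀ i → RunA.inp ρ i ≡ w i))

-- alternate two sequences: f 0, g 0, f 1, g 1, ...
alt : {X : Set} → (ℕ → X) → (ℕ → X) → ℕ → X
alt f g zero = f 0
alt f g (suc n) = alt g (λ m → f (suc m)) n

concatω-go : {X : Set} → X → List X → (ℕ → List⁺ X) → ℕ → X
concatω-go x xs f zero = x
concatω-go x [] f (suc i) with f 0
... | y ∷ ys = concatω-go y ys (λ m → f (suc m)) i
concatω-go x (y ∷ ys) f (suc i) = concatω-go y ys f i

concatω : {X : Set} → (ℕ → List⁺ X) → ℕ → X
concatω f i with f 0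
... | x ∷ xs = concatω-go x xs (λ m → f (suc m)) i

module _ {Sig Gam D : Set} {k : ℕ} {T : NRT Sig Gam k} where
  block : RunT {D = D} T → ℕ → List⁺ ((Sig ⊎ Gam) × D)
  block ρ n = (inj₁ (proj₁ (inp n)) , proj₂ (inp n))
              ∷ map (λ p → inj₂ (proj₁ p) , proj₂ p) (outp n)
    where open RunT ρ

  -- ρ₁ ⊗ ρ₂ = u₁ u₁' v₁ v₁' u₂ u₂' v₂ v₂' ...
  _⊗_ : RunT {D = D} T → RunT {D = D} T → Word ((Sig ⊎ Gam) × D)
  ρ₁ ⊗ ρ₂ = concatω (alt (block ρ₁) (block ρ₂))

L⊗ : {Sig Gam D : Set} {k : ℕ} → NRT Sig Gam k → D → Word ((Sig ⊎ Gam) × D) → Set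
L⊗ {D = D} T d₀ w = ∃[ ρ₁ ] ∃[ ρ₂ ] (AcceptingT T d₀ ρ₁ × AcceptingT T d₀ ρ₂
                     × (∀ i → (_⊗_ {T = T} ρ₁ ρ₂) i ≡ w i))

module Submission where

-- The automaton simulates the two runs in lockstep, reading alternately one block
-- u_n u_n' of the first run and one of the second.  Its 2k registers form two banks
-- holding the valuations of the two runs; its control state records whose turn it
-- is, the current states of both runs, the outputs of the last transition still to
-- be emitted, and a flag reducing the two Büchi conditions to a single one.

open import Defs
open import Data.Nat using (ℕ; zero; suc; _+_; _*_; _≤_; _<_; z≤n; s≤s; s≤s⁻¹)
open import Data.Nat.Properties
  using ( ≤-refl; ≤-trans; ≤-reflexive; ≤-antisym; <-trans; <⇒≤; <⇒≱; ≮⇒≥; ≰⇒>; _≤?_; _<?_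
        ; n≤1+n; n<1+n; m≤n+m; m≤m+n; +-identityʳ; +-suc; +-assoc; +-cancelˡ-≤
        ; m≤n⇒m<n∨m≡n; m≤n⇒∃[o]m+o≡n )
open import Data.Fin using (Fin; zero; _↑ˡ_; _↑ʳ_; splitAt; join)
import Data.Fin.Properties as FinP
open import Data.Fin.Properties using (splitAt-↑ˡ; splitAt-↑ʳ; join-splitAt)
open import Data.Fin.Subset using (Subset)
import Data.Fin.Subset as Subset
open import Data.Vec using (replicate; _++_; tabulate) renaming (lookup to vlookup)
open import Data.Vec.Properties
  using (lookup-++ˡ; lookup-++ʳ; lookup-replicate; lookup∘tabulate; []=⇒lookup; lookup⇒[]=)
open import Data.Bool using (Bool; true; false; if_then_else_) renaming (not to notᵇ; _∧_ to _∧ᵇ_)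
import Data.Bool.Properties as BoolP
open import Data.List
  using (List; []; _∷_; map; length; lookup; concatMap; allFin; tails; null; cartesianProduct)
  renaming (_++_ to _++ₗ_)
open import Data.List.Properties using (∷-injective; map-cong; map-∘; length-map)
import Data.List.Properties as ListP
open import Data.List.NonEmpty using (List⁺; _∷_; toList)
  renaming (map to map⁺; head to head⁺; tail to tail⁺; length to length⁺)
open import Data.List.Relation.Unary.Any using (here; there; index)
import Data.List.Relation.Unary.Any as Any
open import Data.List.Relation.Unary.Any.Properties using (lookup-index)
open import Data.List.Membership.Propositional using (_∈_)
open import Data.List.Membership.Propositional.Properties
  using (∈-map⁺; ∈-map⁻; ∈-++⁺ˡ; ∈-++⁺ʳ; ∈-concatMap⁺; ∈-allFin; ∈-cartesianProduct⁺; ∈-lookup)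
import Data.List.Membership.DecPropositional as DecMembership
open import Data.Sum using (_⊎_; inj₁; inj₂; [_,_]′)
open import Data.Product using (_×_; _,_; proj₁; proj₂; ∃-syntax; Σ)
import Data.Product.Properties as ProductP
open import Data.Empty using (⊥-elim)
open import Function using (id; case_of_)
open import Function.Properties.Inverse using (↔⇒↣)
open import Relation.Nullary using (¬_; yes; no)
open import Relation.Nullary.Decidable using (map′)
open import Relation.Binary.Definitions using (DecidableEquality)
open import Relation.Binary.PropositionalEquality

Chain : {X : Set} → (X → X → Set) → X → List X → X → Set
Chain R x [] y = R x y
Chain R x (x' ∷ xs) y = R x x' × Chain R x' xs y

concatω-chain : {X : Set} (R : X → X → Set) (f : ℕ → List⁺ X)
  → (∀ n → Chain R (head⁺ (f n)) (tail⁺ (f n)) (head⁺ (f (suc n))))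
  → ∀ i → R (concatω f i) (concatω f (suc i))
concatω-chain {X} R f linked i with f 0 | linked 0
... | x ∷ xs | c₀ = go x xs (λ m → f (suc m)) c₀ (λ m → linked (suc m)) i
  where
  go : ∀ x xs (g : ℕ → List⁺ X) → Chain R x xs (head⁺ (g 0))
     → (∀ n → Chain R (head⁺ (g n)) (tail⁺ (g n)) (head⁺ (g (suc n))))
     → ∀ i → R (concatω-go x xs g i) (concatω-go x xs g (suc i))
  go x [] g c lg zero with g 0
  ... | _ ∷ _ = c
  go x (x' ∷ xs) g c lg zero = proj₁ c
  go x (x' ∷ xs) g c lg (suc i) = go x' xs g (proj₂ c) lg i
  go x [] g c lg (suc i) with g 0 | lg 0
  ... | y ∷ ys | c' = go y ys (λ m → g (suc m)) c' (λ m → lg (suc m)) i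

concatω-map : {X Y : Set} (h : X → Y) (f : ℕ → List⁺ X) (g : ℕ → List⁺ Y)
  → (∀ n → map⁺ h (f n) ≡ g n) → ∀ i → h (concatω f i) ≡ concatω g i
concatω-map {X} {Y} h f g e i with f 0 | g 0 | e 0
... | x ∷ xs | ._ | refl = go x xs (λ m → f (suc m)) (λ m → g (suc m)) (λ m → e (suc m)) i
  where
  go : ∀ x xs (f' : ℕ → List⁺ X) (g' : ℕ → List⁺ Y) → (∀ n → map⁺ h (f' n) ≡ g' n)
     → ∀ i → h (concatω-go x xs f' i) ≡ concatω-go (h x) (map h xs) g' i
  go x xs f' g' e' zero = refl
  go x (y ∷ ys) f' g' e' (suc i) = go y ys f' g' e' i
  go x [] f' g' e' (suc i) with f' 0 | g' 0 | e' 0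
  ... | y ∷ ys | ._ | refl = go y ys (λ m → f' (suc m)) (λ m → g' (suc m)) (λ m → e' (suc m)) i

concatω-head : {X : Set} (f : ℕ → List⁺ X) (n : ℕ) → ∃[ i ] (n ≤ i × concatω f i ≡ head⁺ (f n))
concatω-head f zero with f 0
... | _ ∷ _ = 0 , z≤n , refl
concatω-head f (suc n) with concatω-head (λ m → f (suc m)) n
... | i , n≤i , e = length⁺ (f 0) + i , ≤-trans (s≤s n≤i) (s≤s (m≤n+m i _)) , trans (shift f i) e
  where
  shift : ∀ {X : Set} (f : ℕ → List⁺ X) i → concatω f (length⁺ (f 0) + i) ≡ concatω (λ m → f (suc m)) i
  shift f i with f 0
  ... | x ∷ xs = go x xs
    where
    go : ∀ x xs → concatω-go x xs (λ m → f (suc m)) (suc (length xs + i)) ≡ concatω (λ m → f (suc m)) i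
    go x [] with f 1
    ... | _ ∷ _ = refl
    go x (y ∷ ys) = go y ys

segment : {X : Set} → Word X → ℕ → ℕ → List X
segment w q zero = []
segment w q (suc n) = w q ∷ segment w (suc q) n

concatω-segments : {X : Set} (w : Word X) (f : ℕ → List⁺ X) (P : ℕ → ℕ)
  → P 0 ≡ 0
  → (∀ m → P (suc m) ≡ P m + length⁺ (f m))
  → (∀ m → segment w (P m) (length⁺ (f m)) ≡ toList (f m))
  → ∀ i → concatω f i ≡ w i
concatω-segments {X} w f P P₀ P-step seg i with f 0 | P-step 0 | seg 0
... | y ∷ ys | s₀ | g₀ rewrite P₀ =
  go y ys (λ m → f (suc m)) 0 (λ m → P (suc m)) g₀ s₀ (λ m → P-step (suc m)) (λ m → seg (suc m)) i
  where
  go : ∀ x xs (g : ℕ → List⁺ X) q (Q : ℕ → ℕ)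
     → segment w q (suc (length xs)) ≡ x ∷ xs → Q 0 ≡ q + suc (length xs)
     → (∀ m → Q (suc m) ≡ Q m + length⁺ (g m))
     → (∀ m → segment w (Q m) (length⁺ (g m)) ≡ toList (g m))
     → ∀ i → concatω-go x xs g i ≡ w (q + i)
  go x xs g q Q s Q₀ Q-step sg zero = trans (sym (proj₁ (∷-injective s))) (cong w (sym (+-identityʳ q)))
  go x (y ∷ ys) g q Q s Q₀ Q-step sg (suc i) =
    trans (go y ys g (suc q) Q (proj₂ (∷-injective s)) (trans Q₀ (+-suc q _)) Q-step sg i) (cong w (sym (+-suc q i)))
  go x [] g q Q s Q₀ Q-step sg (suc i) with g 0 | Q-step 0 | sg 0
  ... | y ∷ ys | s₀ | g₀ =
    trans (go y ys (λ m → g (suc m)) (Q 0) (λ m → Q (suc m)) g₀ s₀ (λ m → Q-step (suc m)) (λ m → sg (suc m)) i)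
          (cong w (trans (cong (_+ i) Q₀) (+-assoc q 1 i)))

-- Position of the n-th element of f (b = true) or of g (b = false) in alt f g.
idx : Bool → ℕ → ℕ
idx b zero = if b then 0 else 1
idx b (suc n) = suc (suc (idx b n))

alt-idx : {X : Set} (f g : ℕ → X) (b : Bool) (n : ℕ) → alt f g (idx b n) ≡ (if b then f n else g n)
alt-idx f g true zero = refl
alt-idx f g false zero = refl
alt-idx f g b (suc n) = alt-idx (λ m → f (suc m)) (λ m → g (suc m)) b n

idx-onto : ∀ m → ∃[ b ] ∃[ n ] (m ≡ idx b n)
idx-onto zero = true , 0 , refl
idx-onto (suc zero) = false , 0 , refl
idx-onto (suc (suc m)) with idx-onto m
... | b , n , e = b , suc n , cong (λ z → suc (suc z)) e

n≤idx : ∀ b n → n ≤ idx b n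
n≤idx b zero = z≤n
n≤idx b (suc n) = s≤s (≤-trans (n≤idx b n) (n≤1+n _))

idx-false : ∀ n → idx false n ≡ suc (idx true n)
idx-false zero = refl
idx-false (suc n) = cong (λ m → suc (suc m)) (idx-false n)

alt-map : {X Y : Set} (h : X → Y) (f g : ℕ → X) (f' g' : ℕ → Y)
  → (∀ n → h (f n) ≡ f' n) → (∀ n → h (g n) ≡ g' n) → ∀ m → h (alt f g m) ≡ alt f' g' m
alt-map h f g f' g' ef eg zero = ef 0
alt-map h f g f' g' ef eg (suc m) =
  alt-map h g (λ n → f (suc n)) g' (λ n → f' (suc n)) eg (λ n → ef (suc n)) m

alt-linked : {X : Set} (Q : X → X → Set) (f g : ℕ → X)
  → (∀ n → Q (f n) (g n)) → (∀ n → Q (g n) (f (suc n))) → ∀ m → Q (alt f g m) (alt f g (suc m))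
alt-linked Q f g fg gf zero = fg 0
alt-linked Q f g fg gf (suc m) = alt-linked Q g (λ n → f (suc n)) gf (λ n → fg (suc n)) m

InfOften : (ℕ → Set) → Set
InfOften P = ∀ N → ∃[ n ] (N ≤ n × P n)

-- The flag of the usual reduction of a conjunction of two Büchi conditions to
-- one: a lowered flag is raised by an a-visit, a raised flag is lowered by a b-visit.
flagUpd : Bool → Bool → Bool → Bool
flagUpd false a b = a
flagUpd true a b = notᵇ b

module Flag (F a b : ℕ → Bool) (F-step : ∀ n → F (suc n) ≡ flagUpd (F n) (a n) (b n)) where

  private
    stays-down : ∀ {m} → F m ≡ false → a m ≡ false → F (suc m) ≡ false
    stays-down {m} Fm am = trans (F-step m) (cong₂ (λ f x → flagUpd f x (b m)) Fm am)

    up-after-b : ∀ {m} → F m ≡ true → F (suc m) ≡ notᵇ (b m)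
    up-after-b {m} Fm = trans (F-step m) (cong (λ f → flagUpd f (a m) (b m)) Fm)

    shift : ∀ {P : ℕ → Set} m j → P (m + suc j) → P (suc m + j)
    shift {P} m j = subst P (+-suc m j)

  down-until-a : ∀ j {m} → F m ≡ false → a (m + j) ≡ true → ∃[ n ] (m ≤ n × F n ≡ false × a n ≡ true)
  down-until-a j {m} Fm am with a m in am'
  ... | true = m , ≤-refl , Fm , am'
  down-until-a zero {m} Fm am | false = m , ≤-refl , Fm , subst (λ i → a i ≡ true) (+-identityʳ m) am
  down-until-a (suc j) {m} Fm am | false with down-until-a j (stays-down Fm am') (shift {λ i → a i ≡ true} m j am)
  ... | n , m<n , r = n , ≤-trans (n≤1+n m) m<n , r

  up-until-b : ∀ j {m} → F m ≡ true → b (m + j) ≡ true → ∃[ n ] (m < n × F n ≡ false)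
  up-until-b j {m} Fm bm with b m in bm'
  ... | true = suc m , ≤-refl , trans (up-after-b Fm) (cong notᵇ bm')
  up-until-b zero {m} Fm bm | false with trans (sym bm') (subst (λ i → b i ≡ true) (+-identityʳ m) bm)
  ... | ()
  up-until-b (suc j) {m} Fm bm | false
    with up-until-b j (trans (up-after-b Fm) (cong notᵇ bm')) (shift {λ i → b i ≡ true} m j bm)
  ... | n , m<n , r = n , <-trans (n<1+n m) m<n , r

  b-before-down : ∀ j {m} → F m ≡ true → F (m + j) ≡ false → ∃[ n ] (m ≤ n × b n ≡ true)
  b-before-down zero {m} Fm Fn with trans (sym Fm) (subst (λ i → F i ≡ false) (+-identityʳ m) Fn)
  ... | ()
  b-before-down (suc j) {m} Fm Fn with b m in bm'
  ... | true = m , ≤-refl , bm'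
  ... | false with b-before-down j (trans (up-after-b Fm) (cong notᵇ bm')) (shift {λ i → F i ≡ false} m j Fn)
  ...   | n , m<n , r = n , ≤-trans (n≤1+n m) m<n , r

  private
    gap : ∀ {m n} → m ≤ n → ∃[ j ] (m + j ≡ n)
    gap m≤n = m≤n⇒∃[o]m+o≡n m≤n

  flag-complete : InfOften (λ n → a n ≡ true) → InfOften (λ n → b n ≡ true)
                → InfOften (λ n → F n ≡ false × a n ≡ true)
  flag-complete ia ib N with F N in FN
  ... | false with ia N
  ...   | n , N≤n , an with gap N≤n
  ...     | j , refl = down-until-a j FN an
  flag-complete ia ib N | true with ib N
  ...   | n , N≤n , bn with gap N≤n
  ...     | j , refl with up-until-b j FN bn
  ...       | n' , N<n' , Fn' with ia n'
  ...         | n'' , n'≤n'' , an'' with gap n'≤n''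
  ...           | j' , refl with down-until-a j' Fn' an''
  ...             | n₃ , le , r = n₃ , ≤-trans (<⇒≤ N<n') le , r

  flag-sound : InfOften (λ n → F n ≡ false × a n ≡ true) → InfOften (λ n → b n ≡ true)
  flag-sound i N with i N
  ... | n₁ , N≤n₁ , Fn₁ , an₁ with i (suc n₁)
  ...   | n₂ , n₁<n₂ , Fn₂ , _ with gap n₁<n₂
  ...     | j , refl with b-before-down j (trans (F-step n₁) (cong₂ (λ f x → flagUpd f x (b n₁)) Fn₁ an₁)) Fn₂
  ...       | n , n₁<n , bn = n , ≤-trans N≤n₁ (≤-trans (n≤1+n n₁) n₁<n) , bn

module Increasing (f : ℕ → ℕ) (inc : ∀ m → f m < f (suc m)) where

  monotone : ∀ {m m'} → m < m' → f m < f m'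
  monotone {m} {suc m'} (s≤s m≤m') with m≤n⇒m<n∨m≡n m≤m'
  ... | inj₁ m<m' = <-trans (monotone m<m') (inc m')
  ... | inj₂ refl = inc m

  reflects-≤ : ∀ {m m'} → f m ≤ f m' → m ≤ m'
  reflects-≤ {m} {m'} le with m ≤? m'
  ... | yes m≤m' = m≤m'
  ... | no m≰m' = ⊥-elim (<⇒≱ (monotone (≰⇒> m≰m')) le)

  interval : f 0 ≡ 0 → ∀ i → ∃[ m ] (f m ≤ i × i < f (suc m))
  interval f₀ zero = 0 , ≤-reflexive f₀ , subst (_< f 1) f₀ (inc 0)
  interval f₀ (suc i) with interval f₀ i
  ... | m , fm≤i , i<fm' with suc i <? f (suc m)
  ...   | yes i'<fm' = m , ≤-trans fm≤i (n≤1+n i) , i'<fm'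
  ...   | no i'≮fm' = suc m , ≮⇒≥ i'≮fm' , ≤-trans (s≤s (≤-reflexive (≤-antisym i<fm' (≮⇒≥ i'≮fm')))) (inc (suc m))

test-ext : {D : Set} {k : ℕ} (φ : Test k) {τ τ' : Fin k → D} {d : D}
  → (∀ r → τ r ≡ τ' r) → ⟦ φ ⟧ τ d → ⟦ φ ⟧ τ' d
test-ext' : {D : Set} {k : ℕ} (φ : Test k) {τ τ' : Fin k → D} {d : D}
  → (∀ r → τ r ≡ τ' r) → ⟦ φ ⟧ τ' d → ⟦ φ ⟧ τ d
test-ext tt e p = p
test-ext ff e p = p
test-ext (eq r) e p = trans (sym (e r)) p
test-ext (neq r) e p = λ q → p (trans (e r) q)
test-ext (φ ∧ ψ) e (p , q) = test-ext φ e p , test-ext ψ e q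
test-ext (φ ∨ ψ) e (inj₁ p) = inj₁ (test-ext φ e p)
test-ext (φ ∨ ψ) e (inj₂ q) = inj₂ (test-ext ψ e q)
test-ext (not φ) e p = λ q → p (test-ext' φ e q)
test-ext' φ e = test-ext φ (λ r → sym (e r))

upd-ext : {D : Set} {k : ℕ} {τ τ' : Fin k → D} (a : Subset k) (d : D)
  → (∀ r → τ r ≡ τ' r) → ∀ r → upd τ a d r ≡ upd τ' a d r
upd-ext a d e r = cong (if vlookup a r then d else_) (e r)

-- The 2k registers of the product automaton form two banks of k registers,
-- bank true for the first run and bank false for the second.
module Banks (k : ℕ) where

  reg : Bool → Fin k → Fin (2 * k)
  reg true r = r ↑ˡ (k + 0)
  reg false r = k ↑ʳ (r ↑ˡ 0)

  reg-onto : ∀ x → ∃[ b ] ∃[ r ] (x ≡ reg b r)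
  reg-onto x with splitAt k x in e
  ... | inj₁ r = true , r , trans (sym (join-splitAt k (k + 0) x)) (cong (join k (k + 0)) e)
  ... | inj₂ y with splitAt k {0} y in e'
  ...   | inj₁ r = false , r , trans (sym (join-splitAt k (k + 0) x))
                     (trans (cong (join k (k + 0)) e)
                       (cong (k ↑ʳ_) (trans (sym (join-splitAt k 0 y)) (cong (join k 0) e'))))

  bank : {D : Set} → Bool → (Fin (2 * k) → D) → Fin k → D
  bank b V r = V (reg b r)

  combine : {D : Set} → (Fin k → D) → (Fin k → D) → Fin (2 * k) → D
  combine τ₁ τ₂ x = [ τ₁ , (λ y → [ τ₂ , (λ ()) ]′ (splitAt k {0} y)) ]′ (splitAt k x)

  merge : {D : Set} → Bool → (Fin k → D) → (Fin k → D) → Fin (2 * k) → D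
  merge true τ τ' = combine τ τ'
  merge false τ τ' = combine τ' τ

  merge-same : {D : Set} (b : Bool) (τ τ' : Fin k → D) (r : Fin k) → merge b τ τ' (reg b r) ≡ τ r
  merge-same true τ τ' r rewrite splitAt-↑ˡ k r (k + 0) = refl
  merge-same false τ τ' r rewrite splitAt-↑ʳ k (k + 0) (r ↑ˡ 0) | splitAt-↑ˡ k r 0 = refl

  merge-other : {D : Set} (b : Bool) (τ τ' : Fin k → D) (r : Fin k) → merge b τ τ' (reg (notᵇ b) r) ≡ τ' r
  merge-other true τ τ' r = merge-same false τ' τ r
  merge-other false τ τ' r = merge-same true τ' τ r

  shiftAsgn : Bool → Subset k → Subset (2 * k)
  shiftAsgn true a = a ++ replicate (k + 0) false
  shiftAsgn false a = replicate k false ++ (a ++ replicate 0 false)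

  noAsgn : Subset (2 * k)
  noAsgn = replicate (2 * k) false

  upd-noAsgn : {D : Set} (V : Fin (2 * k) → D) (d : D) (x : Fin (2 * k)) → upd V noAsgn d x ≡ V x
  upd-noAsgn V d x rewrite lookup-replicate x false = refl

  upd-shift-same : {D : Set} (b : Bool) (V : Fin (2 * k) → D) (a : Subset k) (d : D) (r : Fin k)
    → upd V (shiftAsgn b a) d (reg b r) ≡ upd (bank b V) a d r
  upd-shift-same true V a d r rewrite lookup-++ˡ a (replicate (k + 0) false) r = refl
  upd-shift-same false V a d r
    rewrite lookup-++ʳ (replicate k false) (a ++ replicate 0 false) (r ↑ˡ 0) | lookup-++ˡ a (replicate 0 false) r = refl

  upd-shift-other : {D : Set} (b : Bool) (V : Fin (2 * k) → D) (a : Subset k) (d : D) (r : Fin k)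
    → upd V (shiftAsgn b a) d (reg (notᵇ b) r) ≡ V (reg (notᵇ b) r)
  upd-shift-other true V a d r
    rewrite lookup-++ʳ a (replicate (k + 0) false) (r ↑ˡ 0) | lookup-replicate {n = k + 0} (r ↑ˡ 0) false = refl
  upd-shift-other false V a d r
    rewrite lookup-++ˡ (replicate k false) (a ++ replicate 0 false) r | lookup-replicate r false = refl

  upd-merge : {D : Set} (b : Bool) (τ τ' τo : Fin k → D) (a : Subset k) (d : D)
    → (∀ r → τ' r ≡ upd τ a d r) → ∀ x → merge b τ' τo x ≡ upd (merge b τ τo) (shiftAsgn b a) d x
  upd-merge b τ τ' τo a d hτ x with reg-onto x
  ... | b' , r , refl = by b b'
    where
    same : ∀ b → merge b τ' τo (reg b r) ≡ upd (merge b τ τo) (shiftAsgn b a) d (reg b r)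
    same b = begin
      merge b τ' τo (reg b r)                        ≡⟨ merge-same b τ' τo r ⟩
      τ' r                                           ≡⟨ hτ r ⟩
      upd τ a d r                                    ≡⟨ upd-ext a d (λ r' → sym (merge-same b τ τo r')) r ⟩
      upd (bank b (merge b τ τo)) a d r              ≡⟨ sym (upd-shift-same b (merge b τ τo) a d r) ⟩
      upd (merge b τ τo) (shiftAsgn b a) d (reg b r) ∎
      where open ≡-Reasoning
    other : ∀ b → merge b τ' τo (reg (notᵇ b) r) ≡ upd (merge b τ τo) (shiftAsgn b a) d (reg (notᵇ b) r)
    other b = trans (merge-other b τ' τo r)
                (sym (trans (upd-shift-other b (merge b τ τo) a d r) (merge-other b τ τo r)))
    by : ∀ b b' → merge b τ' τo (reg b' r) ≡ upd (merge b τ τo) (shiftAsgn b a) d (reg b' r)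
    by true true = same true
    by true false = other true
    by false true = other false
    by false false = same false

  shiftTest : Bool → Test k → Test (2 * k)
  shiftTest b tt = tt
  shiftTest b ff = ff
  shiftTest b (eq r) = eq (reg b r)
  shiftTest b (neq r) = neq (reg b r)
  shiftTest b (φ ∧ ψ) = shiftTest b φ ∧ shiftTest b ψ
  shiftTest b (φ ∨ ψ) = shiftTest b φ ∨ shiftTest b ψ
  shiftTest b (not φ) = not (shiftTest b φ)

  shiftTest-sem : {D : Set} (b : Bool) (φ : Test k) (V : Fin (2 * k) → D) (d : D)
    → ⟦ shiftTest b φ ⟧ V d ≡ ⟦ φ ⟧ (bank b V) d
  shiftTest-sem b tt V d = refl
  shiftTest-sem b ff V d = refl
  shiftTest-sem b (eq r) V d = refl
  shiftTest-sem b (neq r) V d = refl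
  shiftTest-sem b (φ ∧ ψ) V d = cong₂ _×_ (shiftTest-sem b φ V d) (shiftTest-sem b ψ V d)
  shiftTest-sem b (φ ∨ ψ) V d = cong₂ _⊎_ (shiftTest-sem b φ V d) (shiftTest-sem b ψ V d)
  shiftTest-sem b (not φ) V d = cong ¬_ (shiftTest-sem b φ V d)

record Edge (A St : Set) (k : ℕ) : Set where
  field
    from   : St
    letter : A
    guard  : Test k
    assign : Subset k
    to     : St
open Edge

record Takes {A St D : Set} {k : ℕ} (e : Edge A St k)
             (s : St) (τ : Fin k → D) (ℓ : A × D) (s' : St) (τ' : Fin k → D) : Set where
  field
    from≡   : from e ≡ s
    letter≡ : letter e ≡ proj₁ ℓ
    guard✓  : ⟦ guard e ⟧ τ (proj₂ ℓ)
    update  : ∀ r → τ' r ≡ upd τ (assign e) (proj₂ ℓ) r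
    to≡     : to e ≡ s'

module Runs {A St D : Set} {k : ℕ} (δ : List (Edge A St k)) where

  record Run (w : Word (A × D)) : Set where
    field
      ctrl : ℕ → St
      val  : ℕ → Fin k → D
      move : ∀ i → ∃[ e ] (e ∈ δ × Takes e (ctrl i) (val i) (w i) (ctrl (suc i)) (val (suc i)))

  Accepting : St → (St → Bool) → D → {w : Word (A × D)} → Run w → Set
  Accepting s₀ final d₀ ρ = ctrl 0 ≡ s₀ × (∀ r → val 0 r ≡ d₀) × InfOften (λ i → final (ctrl i) ≡ true)
    where open Run ρ

  Accepts : St → (St → Bool) → D → Word (A × D) → Set
  Accepts s₀ final d₀ w = ∃[ ρ ] Accepting s₀ final d₀ {w} ρ

-- With decidable equality on St, the states occurring in δ can be numbered by a
-- Fin type, which turns the automaton into an NRA with the same language.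
module Finitize {A St : Set} {k : ℕ} (_≟_ : DecidableEquality St)
                (δ : List (Edge A St k)) (s₀ : St) (final : St → Bool) where

  states : List St
  states = s₀ ∷ map from δ ++ₗ map to δ

  from∈ : ∀ {e} → e ∈ δ → from e ∈ states
  from∈ e∈ = there (∈-++⁺ˡ (∈-map⁺ from e∈))

  to∈ : ∀ {e} → e ∈ δ → to e ∈ states
  to∈ e∈ = there (∈-++⁺ʳ (map from δ) (∈-map⁺ to e∈))

  -- Position in states (states outside the list are irrelevant).
  encode : St → Fin (length states)
  encode s with DecMembership._∈?_ _≟_ s states
  ... | yes s∈ = index s∈
  ... | no _ = zero

  decode : Fin (length states) → St
  decode = lookup states

  decode-encode : ∀ {s} → s ∈ states → decode (encode s) ≡ s
  decode-encode {s} s∈ with DecMembership._∈?_ _≟_ s states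
  ... | yes s∈' = sym (lookup-index s∈')
  ... | no s∉ = ⊥-elim (s∉ s∈)

  numbered : Edge A St k → TransA A k (length states)
  numbered e = record { src = encode (from e) ; lab = letter e ; test = guard e ; asgn = assign e ; tgt = encode (to e) }

  automaton : NRA A k
  automaton = record
    { nQ = length states ; init = encode s₀ ; acc = tabulate (λ i → final (decode i)) ; trans = map numbered δ }

  accepting-state : ∀ i → i Subset.∈ NRA.acc automaton → final (decode i) ≡ true
  accepting-state i i∈ = trans (sym (lookup∘tabulate (λ j → final (decode j)) i)) ([]=⇒lookup i∈)

  module _ {D : Set} (d₀ : D) where
    open Runs {D = D} δ

    sound : (w : Word (A × D)) → LangA automaton d₀ w → Accepts s₀ final d₀ w
    sound w (ρ , (init≡ , val₀ , inf) , inp≡) = run , init≡' , val₀ , inf'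
      where
      open RunA ρ
      move' : ∀ i → ∃[ e ] (e ∈ δ × Takes e (decode (st i)) (val i) (inp i) (decode (st (suc i))) (val (suc i)))
      move' i with step i
      ... | t , t∈ , src≡ , lab≡ , test✓ , update , tgt≡ with ∈-map⁻ numbered t∈
      ...   | e , e∈ , refl = e , e∈ , record
        { from≡ = trans (sym (decode-encode (from∈ e∈))) (cong decode src≡)
        ; letter≡ = lab≡ ; guard✓ = test✓ ; update = update
        ; to≡ = trans (sym (decode-encode (to∈ e∈))) (cong decode tgt≡) }
      run : Run w
      run = record { ctrl = λ i → decode (st i) ; val = val
                   ; move = λ i → subst (λ ℓ → ∃[ e ] (e ∈ δ × Takes e _ _ ℓ _ _)) (inp≡ i) (move' i) }
      init≡' : decode (st 0) ≡ s₀
      init≡' = trans (cong decode init≡) (decode-encode (here refl))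
      inf' : InfOften (λ i → final (decode (st i)) ≡ true)
      inf' N with inf N
      ... | i , N≤i , i∈ = i , N≤i , accepting-state (st i) i∈

    complete : (w : Word (A × D)) → Accepts s₀ final d₀ w → LangA automaton d₀ w
    complete w (ρ , init≡ , val₀ , inf) = run , (cong encode init≡ , val₀ , inf') , λ i → refl
      where
      open Run ρ
      ctrl∈ : ∀ i → ctrl i ∈ states
      ctrl∈ i with move i
      ... | e , e∈ , tk = subst (_∈ states) (Takes.from≡ tk) (from∈ e∈)
      run : RunA automaton
      run = record
        { st = λ i → encode (ctrl i) ; val = val ; inp = w
        ; step = λ i → case move i of λ { (e , e∈ , tk) →
            numbered e , ∈-map⁺ numbered e∈ , cong encode (Takes.from≡ tk) , Takes.letter≡ tk
            , Takes.guard✓ tk , Takes.update tk , cong encode (Takes.to≡ tk) } }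
      inf' : ∀ N → ∃[ i ] (N ≤ i × encode (ctrl i) Subset.∈ tabulate (λ j → final (decode j)))
      inf' N with inf N
      ... | i , N≤i , fin = i , N≤i , lookup⇒[]= _ _
              (trans (lookup∘tabulate (λ j → final (decode j)) (encode (ctrl i)))
                     (trans (cong final (decode-encode (ctrl∈ i))) fin))

bools : List Bool
bools = true ∷ false ∷ []

∈-bools : ∀ b → b ∈ bools
∈-bools true = here refl
∈-bools false = there (here refl)

∈-concatMap : {X Y : Set} {f : X → List Y} {x : X} {xs : List X} {y : Y} → x ∈ xs → y ∈ f x → y ∈ concatMap f xs
∈-concatMap {f = f} {y = y} x∈ y∈ = ∈-concatMap⁺ f (Any.map (λ e → subst (λ z → y ∈ f z) e y∈) x∈)

tails-tail : {X : Set} {x : X} {o : List X} (l : List X) → (x ∷ o) ∈ tails l → o ∈ tails l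
tails-tail [] (here ())
tails-tail [] (there ())
tails-tail (y ∷ ys) (here refl) = there (here refl)
tails-tail (y ∷ ys) (there o∈) = there (tails-tail ys o∈)

-- The automaton for L⊗(T).  While reading a block u_n u_n' of one run it keeps
-- that run's registers in its bank and the other run's registers untouched.
module Interleave {Sig Gam : Set} (_≟Γ_ : DecidableEquality Gam) {k : ℕ} (T : NRT Sig Gam k) where
  open NRT T renaming (init to i₀; acc to accSet; trans to δT)
  open TransT
  open Banks k

  accepting : Fin nQ → Bool
  accepting q = vlookup accSet q

  -- An output instruction of T: a letter and the register whose value is output.
  Out : Set
  Out = Gam × Fin k

  record Mode : Set where
    constructor mode
    field
      phase : Bool     -- true when the next input letter is read by the first run
      cur   : Fin nQ   -- state of the run reading the next input letter
      oth   : Fin nQ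
      flag  : Bool
  open Mode public

  -- A control state: a mode and the outputs of the last transition still to be emitted.
  Ctrl : Set
  Ctrl = Mode × List Out

  -- Control states have decidable equality, so that Finitize can number them.
  _≟M_ : DecidableEquality Mode
  mode a b c d ≟M mode a' b' c' d' =
    map′ (cong (λ { (a , b , c , d) → mode a b c d })) (cong (λ m → phase m , cur m , oth m , flag m))
      (ProductP.≡-dec BoolP._≟_ (ProductP.≡-dec FinP._≟_ (ProductP.≡-dec FinP._≟_ BoolP._≟_)) (a , b , c , d) (a' , b' , c' , d'))

  _≟C_ : DecidableEquality Ctrl
  _≟C_ = ProductP.≡-dec _≟M_ (ListP.≡-dec (ProductP.≡-dec _≟Γ_ FinP._≟_))

  nextFlag : Bool → Bool → Fin nQ → Fin nQ → Bool
  nextFlag true f q qo = flagUpd f (accepting q) (accepting qo)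
  nextFlag false f q qo = f

  readEdge : Bool → Fin nQ → Bool → TransT Sig Gam k nQ → Edge (Sig ⊎ Gam) Ctrl (2 * k)
  readEdge ph qo f t = record
    { from = mode ph (src t) qo f , []
    ; letter = inj₁ (lab t)
    ; guard = shiftTest ph (test t)
    ; assign = shiftAsgn ph (asgn t)
    ; to = mode (notᵇ ph) qo (tgt t) (nextFlag ph f (src t) qo) , out t }

  -- Emit the next pending output; its data value sits in the bank of the run
  -- that just moved, i.e. of the phase opposite to the current one.
  emitEdge : Mode → Gam → Fin k → List Out → Edge (Sig ⊎ Gam) Ctrl (2 * k)
  emitEdge m γ r o = record
    { from = m , (γ , r) ∷ o
    ; letter = inj₂ γ
    ; guard = eq (reg (notᵇ (phase m)) r)
    ; assign = noAsgn
    ; to = m , o }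

  data Gen : Set where
    input  : Bool → Fin nQ → Bool → Fin (length δT) → Gen
    output : Mode → Gam → Fin k → List Out → Gen

  edgeOf : Gen → Edge (Sig ⊎ Gam) Ctrl (2 * k)
  edgeOf (input ph qo f i) = readEdge ph qo f (lookup δT i)
  edgeOf (output m γ r o) = emitEdge m γ r o

  modes : List Mode
  modes = map (λ { (ph , q , qo , f) → mode ph q qo f })
              (cartesianProduct bools (cartesianProduct (allFin nQ) (cartesianProduct (allFin nQ) bools)))

  ∈-modes : ∀ m → m ∈ modes
  ∈-modes (mode ph q qo f) = ∈-map⁺ _
    (∈-cartesianProduct⁺ (∈-bools ph) (∈-cartesianProduct⁺ (∈-allFin q) (∈-cartesianProduct⁺ (∈-allFin qo) (∈-bools f))))

  -- Pending output lists are suffixes of the outputs of transitions.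
  pendings : List (List Out)
  pendings = concatMap (λ t → tails (out t)) δT

  emits : Mode × List Out → List Gen
  emits (m , []) = []
  emits (m , (γ , r) ∷ o) = output m γ r o ∷ []

  gens : List Gen
  gens = map (λ { (ph , qo , f , i) → input ph qo f i })
             (cartesianProduct bools (cartesianProduct (allFin nQ) (cartesianProduct bools (allFin (length δT)))))
     ++ₗ concatMap emits (cartesianProduct modes pendings)

  input∈ : ∀ ph qo f i → input ph qo f i ∈ gens
  input∈ ph qo f i = ∈-++⁺ˡ (∈-map⁺ _
    (∈-cartesianProduct⁺ (∈-bools ph) (∈-cartesianProduct⁺ (∈-allFin qo) (∈-cartesianProduct⁺ (∈-bools f) (∈-allFin i)))))

  output∈ : ∀ m γ r o {t} → t ∈ δT → ((γ , r) ∷ o) ∈ tails (out t) → output m γ r o ∈ gens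
  output∈ m γ r o t∈ o∈ =
    ∈-++⁺ʳ _ (∈-concatMap (∈-cartesianProduct⁺ (∈-modes m) (∈-concatMap t∈ o∈)) (here refl))

  edges : List (Edge (Sig ⊎ Gam) Ctrl (2 * k))
  edges = map edgeOf gens

  readEdge∈ : ∀ ph qo f {t} → t ∈ δT → readEdge ph qo f t ∈ edges
  readEdge∈ ph qo f t∈ =
    subst (λ t → readEdge ph qo f t ∈ edges) (sym (lookup-index t∈)) (∈-map⁺ edgeOf (input∈ ph qo f (index t∈)))

  emitEdge∈ : ∀ m γ r o {t} → t ∈ δT → ((γ , r) ∷ o) ∈ tails (out t) → emitEdge m γ r o ∈ edges
  emitEdge∈ m γ r o t∈ o∈ = ∈-map⁺ edgeOf (output∈ m γ r o t∈ o∈)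

  start : Ctrl
  start = mode true i₀ i₀ false , []

  final : Ctrl → Bool
  final (m , rem) = phase m ∧ᵇ notᵇ (flag m) ∧ᵇ null rem ∧ᵇ accepting (cur m)

  final-inv : ∀ M rem → final (M , rem) ≡ true
    → phase M ≡ true × flag M ≡ false × rem ≡ [] × accepting (cur M) ≡ true
  final-inv (mode true _ _ false) [] acc = refl , refl , refl , acc
  final-inv (mode true _ _ false) (_ ∷ _) ()
  final-inv (mode true _ _ true) _ ()
  final-inv (mode false _ _ _) _ ()

  automaton : NRA (Sig ⊎ Gam) (2 * k)
  automaton = Finitize.automaton _≟C_ edges start final

  module Complete {D : Set} (d₀ : D) where
    open Runs {D = D} edges

    Config : Set
    Config = Ctrl × (Fin (2 * k) → D)

    -- A position of a run of the automaton: the letter read there, and the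
    -- configuration in which it is read.
    Pos : Set
    Pos = ((Sig ⊎ Gam) × D) × Config

    Into : Pos → Config → Set
    Into x c = ∃[ e ] (e ∈ edges × Takes e (proj₁ (proj₂ x)) (proj₂ (proj₂ x)) (proj₁ x) (proj₁ c) (proj₂ c))

    Next : Pos → Pos → Set
    Next x y = Into x (proj₂ y)

    emitting : Mode → (Fin k → D) → (Fin (2 * k) → D) → List Out → List Pos
    emitting m τ V [] = []
    emitting m τ V ((γ , r) ∷ o) = ((inj₂ γ , τ r) , ((m , (γ , r) ∷ o) , V)) ∷ emitting m τ V o

    emitting-chain : ∀ m τ V {t} → (∀ r → V (reg (notᵇ (phase m)) r) ≡ τ r) → t ∈ δT
      → ∀ o → o ∈ tails (out t) → ∀ x → Into x ((m , o) , V)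
      → ∀ ℓ → Chain Next x (emitting m τ V o) (ℓ , ((m , []) , V))
    emitting-chain m τ V hV t∈ [] o∈ x into ℓ = into
    emitting-chain m τ V hV t∈ ((γ , r) ∷ o) o∈ x into ℓ =
      into , emitting-chain m τ V hV t∈ o (tails-tail _ o∈) _
               (emitEdge m γ r o , emitEdge∈ m γ r o t∈ o∈ , emit) ℓ
      where
      emit : Takes (emitEdge m γ r o) (m , (γ , r) ∷ o) V (inj₂ γ , τ r) (m , o) V
      emit = record { from≡ = refl ; letter≡ = refl ; guard✓ = hV r ; update = λ x → sym (upd-noAsgn V (τ r) x) ; to≡ = refl }

    -- The positions of one block u_n u_n' of the run of phase ph, which reads
    -- ℓ in state q, goes to q' and updates its valuation τ to τ', while the other
    -- run sits in state qo with valuation τo.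
    simBlock : Bool → Sig × D → (q qo q' : Fin nQ) → Bool → (τ τ' τo : Fin k → D) → List Out → List⁺ Pos
    simBlock ph ℓ q qo q' f τ τ' τo o =
      ((inj₁ (proj₁ ℓ) , proj₂ ℓ) , ((mode ph q qo f , []) , merge ph τ τo))
      ∷ emitting (mode (notᵇ ph) qo q' (nextFlag ph f q qo)) τ' (merge ph τ' τo) o

    -- A step of a run of T from (q , τ) reading ℓ to (q' , τ'), as in RunT.step;
    -- Extra t holds the remaining information about the transition t taken.
    TStep : Fin nQ → (Fin k → D) → Sig × D → Fin nQ → (Fin k → D) → (TransT Sig Gam k nQ → Set) → Set
    TStep q τ ℓ q' τ' Extra = ∃[ t ] (t ∈ δT × src t ≡ q × lab t ≡ proj₁ ℓ × ⟦ test t ⟧ τ (proj₂ ℓ)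
                                     × (∀ r → τ' r ≡ upd τ (asgn t) (proj₂ ℓ) r) × tgt t ≡ q' × Extra t)

    simBlock-chain : ∀ ph ℓ q qo q' f τ τ' τo {Extra} (s : TStep q τ ℓ q' τ' Extra)
      → ∀ ℓ' → Chain Next (head⁺ (simBlock ph ℓ q qo q' f τ τ' τo (out (proj₁ s))))
                          (tail⁺ (simBlock ph ℓ q qo q' f τ τ' τo (out (proj₁ s))))
                          (ℓ' , ((mode (notᵇ ph) qo q' (nextFlag ph f q qo) , []) , merge ph τ' τo))
    simBlock-chain ph ℓ _ qo _ f τ τ' τo (t , t∈ , refl , lab≡ , test✓ , update , refl , _) ℓ' =
      emitting-chain _ τ' (merge ph τ' τo) bank-moved t∈ (out t) (here refl) _
        (readEdge ph qo f t , readEdge∈ ph qo f t∈ , read) ℓ'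
      where
      bank-moved : ∀ r → merge ph τ' τo (reg (notᵇ (notᵇ ph)) r) ≡ τ' r
      bank-moved r = trans (cong (λ b → merge ph τ' τo (reg b r)) (BoolP.not-involutive ph)) (merge-same ph τ' τo r)
      read : Takes (readEdge ph qo f t) (mode ph (src t) qo f , []) (merge ph τ τo) (inj₁ (proj₁ ℓ) , proj₂ ℓ)
                   (mode (notᵇ ph) qo (tgt t) (nextFlag ph f (src t) qo) , out t) (merge ph τ' τo)
      read = record
        { from≡ = refl
        ; letter≡ = cong inj₁ lab≡
        ; guard✓ = subst (λ P → P) (sym (shiftTest-sem ph (test t) (merge ph τ τo) (proj₂ ℓ)))
                     (test-ext (test t) (λ r → sym (merge-same ph τ τo r)) test✓)
        ; update = upd-merge ph τ τ' τo (asgn t) (proj₂ ℓ) update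
        ; to≡ = refl }

    simBlock-letters : ∀ ph ℓ q qo q' f τ τ' τo {outp : List (Gam × D)}
      (s : TStep q τ ℓ q' τ' (λ t → outp ≡ map (λ p → proj₁ p , τ' (proj₂ p)) (out t)))
      → map⁺ proj₁ (simBlock ph ℓ q qo q' f τ τ' τo (out (proj₁ s)))
        ≡ (inj₁ (proj₁ ℓ) , proj₂ ℓ) ∷ map (λ p → inj₂ (proj₁ p) , proj₂ p) outp
    simBlock-letters ph ℓ q qo q' f τ τ' τo (t , _ , _ , _ , _ , _ , _ , refl) = cong (_ ∷_) (letters (out t))
      where
      letters : ∀ o → map proj₁ (emitting (mode (notᵇ ph) qo q' (nextFlag ph f q qo)) τ' (merge ph τ' τo) o)
                      ≡ map (λ p → inj₂ (proj₁ p) , proj₂ p) (map (λ p → proj₁ p , τ' (proj₂ p)) o)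
      letters [] = refl
      letters ((γ , r) ∷ o) = cong (_ ∷_) (letters o)

    visits : ∀ {st : ℕ → Fin nQ} → (∀ N → ∃[ n ] (N ≤ n × st n Subset.∈ accSet)) → InfOften (λ n → accepting (st n) ≡ true)
    visits inf N with inf N
    ... | n , N≤n , n∈ = n , N≤n , []=⇒lookup n∈

    module Simulate (ρ₁ ρ₂ : RunT {D = D} T) where
      open RunT ρ₁ renaming (st to st₁; val to val₁; inp to inp₁; outp to outp₁; step to step₁)
      open RunT ρ₂ renaming (st to st₂; val to val₂; inp to inp₂; outp to outp₂; step to step₂)

      flags : ℕ → Bool
      flags zero = false
      flags (suc n) = nextFlag true (flags n) (st₁ n) (st₂ n)

      block₁ block₂ : ℕ → List⁺ Pos
      block₁ n = simBlock true (inp₁ n) (st₁ n) (st₂ n) (st₁ (suc n)) (flags n)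
                          (val₁ n) (val₁ (suc n)) (val₂ n) (out (proj₁ (step₁ n)))
      block₂ n = simBlock false (inp₂ n) (st₂ n) (st₁ (suc n)) (st₂ (suc n)) (flags (suc n))
                          (val₂ n) (val₂ (suc n)) (val₁ (suc n)) (out (proj₁ (step₂ n)))

      blocks : ℕ → List⁺ Pos
      blocks = alt block₁ block₂

      positions : ℕ → Pos
      positions = concatω blocks

      moves : ∀ i → Next (positions i) (positions (suc i))
      moves = concatω-chain Next blocks
        (alt-linked (λ B B' → Chain Next (head⁺ B) (tail⁺ B) (head⁺ B')) block₁ block₂
          (λ n → simBlock-chain true _ _ _ _ _ _ _ _ (step₁ n) _)
          (λ n → simBlock-chain false _ _ _ _ _ _ _ _ (step₂ n) _))

      letters : ∀ i → proj₁ (positions i) ≡ _⊗_ {T = T} ρ₁ ρ₂ i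
      letters = concatω-map proj₁ blocks _
        (alt-map (map⁺ proj₁) block₁ block₂ _ _
          (λ n → simBlock-letters true _ _ _ _ (flags n) _ _ _ (step₁ n))
          (λ n → simBlock-letters false _ _ _ _ (flags (suc n)) _ _ _ (step₂ n)))

      open Flag flags (λ n → accepting (st₁ n)) (λ n → accepting (st₂ n)) (λ n → refl)

      -- The positions where block₁ n starts are accepting when flags n is down and st₁ n is accepting.
      accepting-blocks : AcceptingT T d₀ ρ₁ → AcceptingT T d₀ ρ₂
                       → InfOften (λ i → final (proj₁ (proj₂ (positions i))) ≡ true)
      accepting-blocks (_ , _ , inf₁) (_ , _ , inf₂) N with flag-complete (visits inf₁) (visits inf₂) N
      ... | n , N≤n , flag↓ , acc with concatω-head blocks (idx true n)
      ...   | i , n≤i , at = i , ≤-trans N≤n (≤-trans (n≤idx true n) n≤i) ,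
        trans (cong (λ x → final (proj₁ (proj₂ x))) (trans at (cong head⁺ (alt-idx block₁ block₂ true n))))
              (cong₂ (λ f a → notᵇ f ∧ᵇ a) flag↓ acc)

      run : {w : Word ((Sig ⊎ Gam) × D)} → (∀ i → _⊗_ {T = T} ρ₁ ρ₂ i ≡ w i) → Run w
      run ⊗≡w = record
        { ctrl = λ i → proj₁ (proj₂ (positions i))
        ; val = λ i → proj₂ (proj₂ (positions i))
        ; move = λ i → subst (λ ℓ → Into (ℓ , proj₂ (positions i)) (proj₂ (positions (suc i))))
                             (trans (letters i) (⊗≡w i)) (moves i) }

      initial : AcceptingT T d₀ ρ₁ → AcceptingT T d₀ ρ₂ → ∀ x → merge true (val₁ 0) (val₂ 0) x ≡ d₀
      initial (_ , val₁₀ , _) (_ , val₂₀ , _) x with reg-onto x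
      ... | true , r , refl = trans (merge-same true (val₁ 0) (val₂ 0) r) (val₁₀ r)
      ... | false , r , refl = trans (merge-other true (val₁ 0) (val₂ 0) r) (val₂₀ r)

    complete : ∀ w → L⊗ T d₀ w → Accepts start final d₀ w
    complete w (ρ₁ , ρ₂ , a₁ , a₂ , ⊗≡w) =
      run ⊗≡w , cong₂ (λ q q' → mode true q q' false , []) (proj₁ a₁) (proj₁ a₂) , initial a₁ a₂ , accepting-blocks a₁ a₂
      where open Simulate ρ₁ ρ₂

  module Sound {D : Set} (d₀ : D) (w : Word ((Sig ⊎ Gam) × D)) where
    open Runs {D = D} edges

    after : Mode → TransT Sig Gam k nQ → Mode
    after M t = mode (notᵇ (phase M)) (oth M) (tgt t) (nextFlag (phase M) (flag M) (cur M) (oth M))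

    blockEnd : ℕ → TransT Sig Gam k nQ → ℕ
    blockEnd p t = suc (p + length (out t))

    module Decompose (ρ : Run w) where
      open Run ρ

      pending : ℕ → List Out
      pending i = proj₂ (ctrl i)

      named : ∀ i → Σ Gen (λ g → Takes (edgeOf g) (ctrl i) (val i) (w i) (ctrl (suc i)) (val (suc i)))
      named i with move i
      ... | e , e∈ , tk with ∈-map⁻ edgeOf e∈
      ...   | g , _ , refl = g , tk

      gen : ℕ → Gen
      gen i = proj₁ (named i)

      takes : ∀ i {g} → gen i ≡ g → Takes (edgeOf g) (ctrl i) (val i) (w i) (ctrl (suc i)) (val (suc i))
      takes i refl = proj₂ (named i)

      record Emission (q : ℕ) (m : Mode) (o : List Out) : Set where
        field
          reaches : ctrl (q + length o) ≡ (m , [])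
          keep    : ∀ x → val (q + length o) x ≡ val q x
          letters : segment w q (length o) ≡ map (λ p → inj₂ (proj₁ p) , val q (reg (notᵇ (phase m)) (proj₂ p))) o
          busy    : ∀ j → j < length o → pending (q + j) ≢ []

      emission : ∀ o q m → ctrl q ≡ (m , o) → Emission q m o
      emission [] q m h = record
        { reaches = subst (λ j → ctrl j ≡ (m , [])) (sym (+-identityʳ q)) h
        ; keep = λ x → cong (λ j → val j x) (+-identityʳ q)
        ; letters = refl
        ; busy = λ j () }
      emission ((γ , r) ∷ o) q m h with gen q in e
      ... | input _ _ _ _ with trans (Takes.from≡ (takes q e)) h
      ...   | ()
      emission ((γ , r) ∷ o) q m h | output _ _ _ _ with trans (Takes.from≡ (takes q e)) h
      ...   | refl = record
        { reaches = subst (λ j → ctrl j ≡ (m , [])) (sym (+-suc q (length o))) (Emission.reaches rest)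
        ; keep = λ x → trans (cong (λ j → val j x) (+-suc q (length o))) (trans (Emission.keep rest x) (silent x))
        ; letters = cong₂ _∷_ (cong₂ _,_ (sym (Takes.letter≡ tk)) (sym (Takes.guard✓ tk)))
                      (trans (Emission.letters rest) (map-cong (λ p → cong (λ d → inj₂ (proj₁ p) , d) (silent _)) o))
        ; busy = busy }
        where
        tk : Takes (emitEdge m γ r o) (ctrl q) (val q) (w q) (ctrl (suc q)) (val (suc q))
        tk = takes q e
        rest : Emission (suc q) m o
        rest = emission o (suc q) m (sym (Takes.to≡ tk))
        silent : ∀ x → val (suc q) x ≡ val q x
        silent x = trans (Takes.update tk x) (upd-noAsgn (val q) _ x)
        busy : ∀ j → j < suc (length o) → pending (q + j) ≢ []
        busy zero _ idle with trans (sym (cong proj₂ h)) (subst (λ j → pending j ≡ []) (+-identityʳ q) idle)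
        ... | ()
        busy (suc j) (s≤s j<) idle = Emission.busy rest j j< (subst (λ i → pending i ≡ []) (+-suc q j) idle)

      -- From a control state in mode M with nothing pending, the run reads the
      -- input letter of a transition t of the run of phase M and then emits its
      -- outputs: the block of t occupies the positions p, ..., blockEnd p t - 1.
      record Block (p : ℕ) (M : Mode) : Set where
        field
          t       : TransT Sig Gam k nQ
          t∈      : t ∈ δT
          src≡    : src t ≡ cur M
          test✓   : ⟦ test t ⟧ (bank (phase M) (val p)) (proj₂ (w p))
          update  : ∀ r → val (blockEnd p t) (reg (phase M) r) ≡ upd (bank (phase M) (val p)) (asgn t) (proj₂ (w p)) r
          keep    : ∀ r → val (blockEnd p t) (reg (notᵇ (phase M)) r) ≡ val p (reg (notᵇ (phase M)) r)
          reaches : ctrl (blockEnd p t) ≡ (after M t , [])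
          letters : segment w p (suc (length (out t)))
                    ≡ (inj₁ (lab t) , proj₂ (w p)) ∷ map (λ o → inj₂ (proj₁ o) , val (blockEnd p t) (reg (phase M) (proj₂ o))) (out t)
          busy    : ∀ j → j < length (out t) → pending (suc p + j) ≢ []

      blockAt : ∀ p M → ctrl p ≡ (M , []) → Block p M
      blockAt p (mode ph q qo f) h with gen p in e
      ... | output _ _ _ _ with trans (Takes.from≡ (takes p e)) h
      ...   | ()
      blockAt p (mode ph q qo f) h | input _ _ _ i with trans (Takes.from≡ (takes p e)) h
      ...   | refl = record
        { t = t
        ; t∈ = ∈-lookup i
        ; src≡ = refl
        ; test✓ = subst id (shiftTest-sem ph (test t) (val p) (proj₂ (w p))) (Takes.guard✓ tk)
        ; update = λ r → trans (Emission.keep em (reg ph r)) (trans (Takes.update tk (reg ph r)) (upd-shift-same ph (val p) (asgn t) _ r))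
        ; keep = λ r → trans (Emission.keep em _) (trans (Takes.update tk _) (upd-shift-other ph (val p) (asgn t) _ r))
        ; reaches = Emission.reaches em
        ; letters = cong₂ _∷_ (cong (_, proj₂ (w p)) (sym (Takes.letter≡ tk)))
                      (trans (Emission.letters em) (map-cong (λ o → cong (λ d → inj₂ (proj₁ o) , d) (own-bank (proj₂ o))) (out t)))
        ; busy = Emission.busy em }
        where
        t : TransT Sig Gam k nQ
        t = lookup δT i
        tk : Takes (readEdge ph qo f t) (ctrl p) (val p) (w p) (ctrl (suc p)) (val (suc p))
        tk = takes p e
        em : Emission (suc p) (after (mode ph (src t) qo f) t) (out t)
        em = emission (out t) (suc p) _ (sym (Takes.to≡ tk))
        -- the outputs read the bank of the run that moved, which emission sees as the other one
        own-bank : ∀ r → val (suc p) (reg (notᵇ (notᵇ ph)) r) ≡ val (blockEnd p t) (reg ph r)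
        own-bank r = trans (cong (λ b → val (suc p) (reg b r)) (BoolP.not-involutive ph)) (sym (Emission.keep em (reg ph r)))

      -- Starting from the initial control state, the run is cut into consecutive
      -- blocks: block m starts at position P m in mode modeAt m.
      module Blocks (ctrl₀ : ctrl 0 ≡ start) where
        mutual
          P : ℕ → ℕ
          P zero = 0
          P (suc m) = blockEnd (P m) (Block.t (blk m))

          modeAt : ℕ → Mode
          modeAt zero = mode true i₀ i₀ false
          modeAt (suc m) = after (modeAt m) (Block.t (blk m))

          blk : ∀ m → Block (P m) (modeAt m)
          blk zero = blockAt 0 _ ctrl₀
          blk (suc m) = blockAt (P (suc m)) _ (Block.reaches (blk m))

        ctrl-at : ∀ m → ctrl (P m) ≡ (modeAt m , [])
        ctrl-at zero = ctrl₀
        ctrl-at (suc m) = Block.reaches (blk m)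

        phase-idx : ∀ b n → phase (modeAt (idx b n)) ≡ b
        phase-idx true zero = refl
        phase-idx false zero = refl
        phase-idx b (suc n) = trans (BoolP.not-involutive _) (phase-idx b n)

        -- Inside a block nothing is idle, so idle positions start blocks.
        idle-at-start : ∀ {m i} → P m ≤ i → i < P (suc m) → pending i ≡ [] → i ≡ P m
        idle-at-start {m} Pm≤i i<P' idle with m≤n⇒∃[o]m+o≡n Pm≤i
        ... | zero , refl = +-identityʳ (P m)
        ... | suc j , refl = ⊥-elim (Block.busy (blk m) j (+-cancelˡ-≤ (P m) _ _ (s≤s⁻¹ i<P'))
                                     (subst (λ i → pending i ≡ []) (+-suc (P m) j) idle))

        open Increasing P (λ m → s≤s (m≤m+n (P m) _)) using (interval) renaming (reflects-≤ to P-reflects-≤)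
        open Increasing (idx true) (λ n → s≤s (n≤1+n _)) using () renaming (reflects-≤ to idx-reflects-≤)

        accepting-blocks : InfOften (λ i → final (ctrl i) ≡ true)
          → InfOften (λ n → flag (modeAt (idx true n)) ≡ false × accepting (cur (modeAt (idx true n))) ≡ true)
        accepting-blocks inf N with inf (P (idx true N))
        ... | i , PN≤i , fin with interval refl i
        ...   | m , Pm≤i , i<P' with idle-at-start Pm≤i i<P' (proj₁ (proj₂ (proj₂ (final-inv (proj₁ (ctrl i)) (pending i) fin))))
        ...     | refl with final-inv (modeAt m) [] (subst (λ c → final c ≡ true) (ctrl-at m) fin)
        ...       | ph , fl , _ , acc with idx-onto m
        ...         | b , n , refl with trans (sym (phase-idx b n)) ph
        ...           | refl = n , idx-reflects-≤ (P-reflects-≤ PN≤i) , fl , acc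

        module RunOf (b : Bool) where
          M : ℕ → Mode
          M n = modeAt (idx b n)

          B : ∀ n → Block (P (idx b n)) (M n)
          B n = blk (idx b n)

          tr : ℕ → TransT Sig Gam k nQ
          tr n = Block.t (B n)

          -- The next block belongs to the other run and keeps this run's bank.
          kept : ∀ n r → val (P (idx b (suc n))) (reg (phase (M (suc n))) r) ≡ val (P (suc (idx b n))) (reg (phase (M n)) r)
          kept n r = trans (Block.keep (blk (suc (idx b n))) r)
                           (cong (λ c → val (P (suc (idx b n))) (reg c r)) (BoolP.not-involutive (phase (M n))))

          run : RunT {D = D} T
          run = record
            { st = λ n → cur (M n)
            ; val = λ n → bank (phase (M n)) (val (P (idx b n)))
            ; inp = λ n → lab (tr n) , proj₂ (w (P (idx b n)))
            ; outp = λ n → map (λ o → proj₁ o , val (P (idx b (suc n))) (reg (phase (M (suc n))) (proj₂ o))) (out (tr n))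
            ; step = λ n → tr n , Block.t∈ (B n) , Block.src≡ (B n) , refl , Block.test✓ (B n)
                           , (λ r → trans (kept n r) (Block.update (B n) r)) , refl , refl }

          block-length : ∀ n → length⁺ (block {T = T} run n) ≡ suc (length (out (tr n)))
          block-length n = cong suc (trans (length-map _ (RunT.outp run n)) (length-map _ (out (tr n))))

          block-letters : ∀ n → segment w (P (idx b n)) (suc (length (out (tr n)))) ≡ toList (block {T = T} run n)
          block-letters n = trans (Block.letters (B n)) (cong ((inj₁ (lab (tr n)) , proj₂ (w (P (idx b n)))) ∷_)
            (trans (map-cong (λ o → cong (λ d → inj₂ (proj₁ o) , d) (sym (kept n (proj₂ o)))) (out (tr n)))
                   (map-∘ (out (tr n)))))

        open RunOf using (run)

        blocks : ℕ → List⁺ ((Sig ⊎ Gam) × D)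
        blocks = alt (block {T = T} (run true)) (block {T = T} (run false))

        blocks-idx : ∀ b n → blocks (idx b n) ≡ block {T = T} (run b) n
        blocks-idx true n = alt-idx _ _ true n
        blocks-idx false n = alt-idx _ _ false n

        interleaving : ∀ i → _⊗_ {T = T} (run true) (run false) i ≡ w i
        interleaving = concatω-segments w blocks P refl P-step segments
          where
          P-step : ∀ m → P (suc m) ≡ P m + length⁺ (blocks m)
          P-step m with idx-onto m
          ... | b , n , refl = sym (trans (cong (P (idx b n) +_) (trans (cong length⁺ (blocks-idx b n)) (RunOf.block-length b n)))
                                          (+-suc (P (idx b n)) _))
          segments : ∀ m → segment w (P m) (length⁺ (blocks m)) ≡ toList (blocks m)
          segments m with idx-onto m
          ... | b , n , refl rewrite blocks-idx b n =
            trans (cong (segment w (P (idx b n))) (RunOf.block-length b n)) (RunOf.block-letters b n)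

        flag-step : ∀ n → flag (modeAt (idx true (suc n)))
                        ≡ flagUpd (flag (modeAt (idx true n))) (accepting (cur (modeAt (idx true n)))) (accepting (oth (modeAt (idx true n))))
        flag-step n = twice (phase-idx true n)
          where
          twice : ∀ {ph f q qo q' q''} → ph ≡ true → nextFlag (notᵇ ph) (nextFlag ph f q qo) q' q'' ≡ flagUpd f (accepting q) (accepting qo)
          twice refl = refl

        open Flag (λ n → flag (modeAt (idx true n))) (λ n → accepting (cur (modeAt (idx true n))))
                  (λ n → accepting (oth (modeAt (idx true n)))) flag-step

        run₁-accepting : (∀ r → val 0 r ≡ d₀) → InfOften (λ i → final (ctrl i) ≡ true) → AcceptingT T d₀ (run true)
        run₁-accepting val₀ inf = refl , (λ r → val₀ (reg true r)) , visits
          where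
          visits : ∀ N → ∃[ n ] (N ≤ n × cur (modeAt (idx true n)) Subset.∈ accSet)
          visits N = case accepting-blocks inf N of λ { (n , N≤n , _ , acc) → n , N≤n , lookup⇒[]= _ accSet acc }

        run₂-accepting : (∀ r → val 0 r ≡ d₀) → InfOften (λ i → final (ctrl i) ≡ true) → AcceptingT T d₀ (run false)
        run₂-accepting val₀ inf = refl , (λ r → trans (Block.keep (blk 0) r) (val₀ (reg false r))) , visits
          where
          visits : ∀ N → ∃[ n ] (N ≤ n × cur (modeAt (idx false n)) Subset.∈ accSet)
          visits N = case flag-sound (accepting-blocks inf) N of λ { (n , N≤n , acc) →
            n , N≤n , lookup⇒[]= _ accSet (trans (cong (λ m → accepting (cur (modeAt m))) (idx-false n)) acc) }

    sound : Accepts start final d₀ w → L⊗ T d₀ w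
    sound (ρ , ctrl₀ , val₀ , inf) =
      RunOf.run true , RunOf.run false , run₁-accepting val₀ inf , run₂-accepting val₀ inf , interleaving
      where
      open Decompose ρ
      open Blocks ctrl₀

finite-≟ : {A : Set} → Finite A → DecidableEquality A
finite-≟ (n , A↔Fin) = FinP.inj⇒≟ (↔⇒↣ A↔Fin)

lemma1 : {Sig Gam D : Set} → Finite Sig → Finite Gam → CountablyInfinite D → (d₀ : D)
    → (k : ℕ) → (T : NRT Sig Gam k) → OutputInfinite T d₀
    → Σ (NRA (Sig ⊎ Gam) (2 * k)) (λ M → ∀ (w : Word ((Sig ⊎ Gam) × D))
    → (LangA M d₀ w → L⊗ T d₀ w) × (L⊗ T d₀ w → LangA M d₀ w))
lemma1 _ finGam _ d₀ k T _ =
  automaton , λ w → (λ accepted → Sound.sound d₀ w (Numbered.sound d₀ w accepted))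
                  , (λ pair → Numbered.complete d₀ w (Complete.complete d₀ w pair))
  where
  open Interleave (finite-≟ finGam) T
  module Numbered = Finitize _≟C_ edges start final
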